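{- Let $n$ be a positive integer divisible by $3$. In the $(1 : 1)$ Maker-Breaker game $\mathcal{TF}_n$, Breaker has a strategy ensuring that Maker does not win in fewer than $7n/6$ moves.
   Context: $\mathcal{TF}_n$ is the Maker-Breaker game whose board is the edge set $E(K_n)$ of the complete graph on $n$ vertices and whose winning sets are the edge sets of the triangle factors of $K_n$ (spanning subgraphs each of whose connected components is a triangle $K_3$). In the $(1:1)$ version Maker and Breaker alternately claim one previously unclaimed edge each; Maker wins as soon as his edges contain a triangle factor of $K_n$. -}

module Defs where

open import Data.Nat using (ℕ; suc; _*_; _<_)
open import Data.Fin as F using (Fin)
open import Data.Fin.Properties using ()
open import Data.List using (List; []; _∷_; _++_; [_]; concatMap; length)
open import Data.List.Membership.Propositional using (_∈_; _∉_)
open import Data.List.Relation.Binary.Permutation.Propositional using (_↭_)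
open import Data.Product using (Σ; ∃; _×_; _,_)
open import Data.Sum using (_⊎_)
open import Data.List using (allFin)

-- An edge of K_n: an unordered pair {i, j}, represented canonically as (i , j) with i < j.
Edge : ℕ → Set
Edge n = Σ (Fin n × Fin n) (λ p → let (i , j) = p in i F.< j)

Adj : ∀ {n} → List (Edge n) → Fin n → Fin n → Set
Adj E u v = (Σ (u F.< v) λ p → ((u , v) , p) ∈ E) ⊎ (Σ (v F.< u) λ p → ((v , u) , p) ∈ E)

Triple : ℕ → Set
Triple n = Fin n × Fin n × Fin n

verts : ∀ {n} → List (Triple n) → List (Fin n)
verts = concatMap (λ { (a , b , c) → a ∷ b ∷ c ∷ [] })

TriangleIn : ∀ {n} → List (Edge n) → Triple n → Set
TriangleIn E (a , b , c) = Adj E a b × Adj E b c × Adj E a c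

data AllTri {n} (E : List (Edge n)) : List (Triple n) → Set where
  []  : AllTri E []
  _∷_ : ∀ {t ts} → TriangleIn E t → AllTri E ts → AllTri E (t ∷ ts)

-- E contains a triangle factor of K_n: a collection of triangles, all of whose edges
-- lie in E, such that every vertex of K_n lies in exactly one of them
-- (the vertex list of the triangles is a permutation of all vertices).
ContainsTriangleFactor : ∀ {n} → List (Edge n) → Set
ContainsTriangleFactor {n} E =
  Σ (List (Triple n)) λ T → AllTri E T × (verts T ↭ allFin n)

-- Game history: chronological list of claimed edges; Maker claims the 1st, 3rd, 5th, ...
makerEdges : ∀ {A : Set} → List A → List A
makerEdges []           = []
makerEdges (x ∷ [])     = x ∷ []
makerEdges (x ∷ _ ∷ xs) = x ∷ makerEdges xs

-- A Breaker strategy maps the history (ending with Maker's last move) to Breaker's reply.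
BreakerStrategy : ℕ → Set
BreakerStrategy n = List (Edge n) → Edge n

LegalBreaker : ∀ {n} → BreakerStrategy n → Set
LegalBreaker {n} sB = ∀ (h : List (Edge n)) → (Σ (Edge n) λ e → e ∉ h) → sB h ∉ h

-- Reachable sB h k : h is a history at Maker's turn after k full rounds, in which Maker
-- played arbitrary legal moves and Breaker followed sB.
data Reachable {n} (sB : BreakerStrategy n) : List (Edge n) → ℕ → Set where
  start : Reachable sB [] 0
  step  : ∀ {h k} → Reachable sB h k → (e : Edge n) → e ∉ h →
          Reachable sB (h ++ e ∷ sB (h ++ [ e ]) ∷ []) (suc k)

module Submission where

-- Breaker's strategy: after Maker claims e = uv, claim a free edge vw that
-- closes a cherry formed by e and one of Maker's edges uw, if there is one;
-- otherwise claim any free edge.  Call a set of vertices S "leaky" for Maker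
-- if one of Maker's edges joins a vertex of S to a vertex outside S.  The
-- strategy keeps the invariant: every Maker cherry a-b, a-c is leaky on
-- {a,b,c} or Breaker owns bc.  Consequently, after any Maker move every Maker
-- triangle is leaky.  Counting edge endpoints inside the triangles of a factor
-- T then gives 7|T| ≤ 2|M| (each triangle receives its 6 own endpoints plus
-- one from a leaving edge), and with n = 3|T| this is 7n ≤ 6|M|.

open import Defs
open import Data.Nat using (ℕ; suc; zero; _*_; _+_; _<_; _≤_; NonZero; z≤n; s≤s)
open import Data.Nat.Properties
  using (≤-reflexive; ≤-trans; +-mono-≤; +-monoʳ-≤; m≤m+n; m≤n+m; *-monoʳ-≤; *-assoc; *-suc; +-comm;
         <⇒≤; <⇒≱; +-commutativeSemigroup; module ≤-Reasoning)
open import Algebra.Properties.CommutativeSemigroup +-commutativeSemigroup using (interchange)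
open import Data.Nat.Divisibility using (_∣_; ∣⇒≤)
open import Data.Nat.ListAction using (sum)
open import Data.Nat.ListAction.Properties using (sum-++; sum-↭)
open import Data.Fin as F using (Fin)
open import Data.Fin.Properties using (_≟_; _<?_; <-cmp; <-irrefl; <-irrelevant; <-asym; any?)
open import Data.List using (List; []; _∷_; _++_; [_]; length; map; foldl; allFin; tabulate)
open import Data.List.Properties using (length-++; length-tabulate; map-++; map-tabulate; foldl-++)
open import Data.List.Membership.Propositional using (_∈_; _∉_; find; lose)
open import Data.List.Membership.Propositional.Properties using (∈-++⁺ˡ; ∈-++⁺ʳ; ∈-++⁻; ∈-∃++)
open import Data.List.Membership.DecPropositional using () renaming (_∈?_ to member?)
open import Data.List.Relation.Unary.Any as Any using (Any; here; there)
open import Data.List.Relation.Unary.Any.Properties using (++⁻)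
open import Data.List.Relation.Unary.All as All using ([]; _∷_)
open import Data.List.Relation.Unary.AllPairs using ([]; _∷_)
open import Data.List.Relation.Unary.Unique.Propositional using (Unique)
open import Data.List.Relation.Binary.Subset.Propositional using (_⊆_)
open import Data.List.Relation.Binary.Subset.Propositional.Properties using (Any-resp-⊆; ++⁺ˡ; ++⁺ʳ; xs⊆xs++ys)
open import Data.List.Relation.Binary.Disjoint.Propositional using (Disjoint)
open import Data.List.Relation.Binary.Permutation.Propositional using (_↭_; ↭-refl; ↭-sym; ↭-trans; prep; swap)
open import Data.List.Relation.Binary.Permutation.Propositional.Properties using (∈-resp-↭; ↭-length; map⁺; shift)
open import Data.Product using (Σ; ∃; ∃₂; _×_; _,_; proj₁; proj₂)
open import Data.Product.Properties using (≡-dec)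
open import Data.Sum as Sum using (_⊎_; inj₁; inj₂)
open import Data.Empty using (⊥-elim)
open import Function using (_∘_; id)
open import Relation.Nullary using (¬_; Dec; yes; no; contradiction)
open import Relation.Nullary.Decidable using (_×-dec_; _⊎-dec_; ¬?; map′)
open import Relation.Unary using (Decidable)
open import Relation.Binary.Definitions using (DecidableEquality; tri<; tri≈; tri>)
open import Relation.Binary.PropositionalEquality
  using (_≡_; _≢_; refl; sym; trans; cong; cong₂; subst; subst₂; ≢-sym)

module _ {A : Set} where

  breakerEdges : List A → List A
  breakerEdges []           = []
  breakerEdges (_ ∷ [])     = []
  breakerEdges (_ ∷ y ∷ xs) = y ∷ breakerEdges xs

  data Paired : List A → Set where
    []    : Paired []
    round : ∀ x y {xs} → Paired xs → Paired (x ∷ y ∷ xs)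

  paired-snoc : ∀ {h} x y → Paired h → Paired (h ++ x ∷ y ∷ [])
  paired-snoc x y []             = round x y []
  paired-snoc x y (round a b ph) = round a b (paired-snoc x y ph)

  makerEdges-++ : ∀ {h} → Paired h → (xs : List A) →
                  makerEdges (h ++ xs) ≡ makerEdges h ++ makerEdges xs
  makerEdges-++ []             xs = refl
  makerEdges-++ (round a _ ph) xs = cong (a ∷_) (makerEdges-++ ph xs)

  breakerEdges-++ : ∀ {h} → Paired h → (xs : List A) →
                    breakerEdges (h ++ xs) ≡ breakerEdges h ++ breakerEdges xs
  breakerEdges-++ []             xs = refl
  breakerEdges-++ (round _ b ph) xs = cong (b ∷_) (breakerEdges-++ ph xs)

  makerEdges-⊆ : (xs : List A) → makerEdges xs ⊆ xs
  makerEdges-⊆ (_ ∷ [])     m         = m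
  makerEdges-⊆ (_ ∷ _ ∷ xs) (here p)  = here p
  makerEdges-⊆ (_ ∷ _ ∷ xs) (there m) = there (there (makerEdges-⊆ xs m))

  breakerEdges-⊆ : (xs : List A) → breakerEdges xs ⊆ xs
  breakerEdges-⊆ (_ ∷ _ ∷ xs) (here p)  = there (here p)
  breakerEdges-⊆ (_ ∷ _ ∷ xs) (there m) = there (there (breakerEdges-⊆ xs m))

  claimed-by : (xs : List A) {x : A} → x ∈ xs → x ∈ makerEdges xs ⊎ x ∈ breakerEdges xs
  claimed-by (_ ∷ [])     (here p)          = inj₁ (here p)
  claimed-by (_ ∷ _ ∷ xs) (here p)          = inj₁ (here p)
  claimed-by (_ ∷ _ ∷ xs) (there (here p))  = inj₂ (here p)
  claimed-by (_ ∷ _ ∷ xs) (there (there m)) = Sum.map there there (claimed-by xs m)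

  length-snoc : (xs : List A) (x : A) → length (xs ++ [ x ]) ≡ suc (length xs)
  length-snoc xs x = trans (length-++ xs) (+-comm (length xs) 1)

  rotate : (a b c : A) → c ∷ a ∷ b ∷ [] ↭ a ∷ b ∷ c ∷ []
  rotate a b c = ↭-trans (swap c a ↭-refl) (prep a (swap c b ↭-refl))

  ∈-delete : ∀ {x z : A} (ys₁ ys₂ : List A) → z ∈ ys₁ ++ x ∷ ys₂ → z ≢ x → z ∈ ys₁ ++ ys₂
  ∈-delete ys₁ ys₂ z∈ z≢x with ∈-resp-↭ (shift _ ys₁ ys₂) z∈
  ... | here z≡x = contradiction z≡x z≢x
  ... | there m  = m

  sum-delete : (f : A → ℕ) {x : A} (ys₁ ys₂ : List A) →
               sum (map f (ys₁ ++ x ∷ ys₂)) ≡ f x + sum (map f (ys₁ ++ ys₂))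
  sum-delete f ys₁ ys₂ = sum-↭ (map⁺ f (shift _ ys₁ ys₂))

  sum-distinct-≤ : (f : A → ℕ) {xs ys : List A} → Unique xs → xs ⊆ ys →
                   sum (map f xs) ≤ sum (map f ys)
  sum-distinct-≤ f [] _ = z≤n
  sum-distinct-≤ f {x ∷ xs} (x≢xs ∷ distinct) sub
    with ys₁ , ys₂ , refl ← ∈-∃++ (sub (here refl)) =
    ≤-trans (+-monoʳ-≤ (f x) (sum-distinct-≤ f distinct rest)) (≤-reflexive (sym (sum-delete f ys₁ ys₂)))
    where
    rest : xs ⊆ ys₁ ++ ys₂
    rest z∈xs = ∈-delete ys₁ ys₂ (sub (there z∈xs)) (≢-sym (All.lookup x≢xs z∈xs))

δ : ∀ {m} → Fin m → Fin m → ℕ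
δ F.zero    F.zero    = 1
δ F.zero    (F.suc _) = 0
δ (F.suc _) F.zero    = 0
δ (F.suc u) (F.suc v) = δ u v

δ-refl : ∀ {m} (v : Fin m) → δ v v ≡ 1
δ-refl F.zero    = refl
δ-refl (F.suc v) = δ-refl v

δ-total : ∀ {m} (u : Fin m) → sum (tabulate (δ u)) ≡ 1
δ-total {suc m} F.zero    = cong suc (zeros m)
  where
  zeros : ∀ k → sum (tabulate {n = k} (λ _ → 0)) ≡ 0
  zeros zero    = refl
  zeros (suc k) = zeros k
δ-total {suc m} (F.suc u) = δ-total u

module _ {n : ℕ} where

  lo hi : Edge n → Fin n
  lo x = proj₁ (proj₁ x)
  hi x = proj₂ (proj₁ x)

  data Joins (x : Edge n) (u v : Fin n) : Set where
    forward  : lo x ≡ u → hi x ≡ v → Joins x u v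
    backward : lo x ≡ v → hi x ≡ u → Joins x u v

  joins? : ∀ x u v → Dec (Joins x u v)
  joins? x u v = map′ from to ((lo x ≟ u ×-dec hi x ≟ v) ⊎-dec (lo x ≟ v ×-dec hi x ≟ u))
    where
    from : (lo x ≡ u × hi x ≡ v) ⊎ (lo x ≡ v × hi x ≡ u) → Joins x u v
    from (inj₁ (p , q)) = forward p q
    from (inj₂ (p , q)) = backward p q
    to : Joins x u v → (lo x ≡ u × hi x ≡ v) ⊎ (lo x ≡ v × hi x ≡ u)
    to (forward p q)  = inj₁ (p , q)
    to (backward p q) = inj₂ (p , q)

  joins-sym : ∀ {x u v} → Joins x u v → Joins x v u
  joins-sym (forward p q)  = backward p q
  joins-sym (backward p q) = forward p q

  joins-≢ : ∀ {x u v} → Joins x u v → u ≢ v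
  joins-≢ {(_ , i<j)} (forward refl refl)  u≡v = <-irrefl u≡v i<j
  joins-≢ {(_ , i<j)} (backward refl refl) u≡v = <-irrefl (sym u≡v) i<j

  joins-ends : ∀ {x u v w z} → Joins x u v → Joins x w z → (w ≡ u × z ≡ v) ⊎ (w ≡ v × z ≡ u)
  joins-ends (forward refl refl)  (forward refl refl)  = inj₁ (refl , refl)
  joins-ends (forward refl refl)  (backward refl refl) = inj₂ (refl , refl)
  joins-ends (backward refl refl) (forward refl refl)  = inj₂ (refl , refl)
  joins-ends (backward refl refl) (backward refl refl) = inj₁ (refl , refl)

  joins-other : ∀ {x u v w} → Joins x u v → Joins x u w → v ≡ w
  joins-other xuv xuw with joins-ends xuv xuw
  ... | inj₁ (_ , w≡v)   = sym w≡v
  ... | inj₂ (u≡v , _)   = contradiction u≡v (joins-≢ xuv)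

  edges-differ : ∀ {x y u v w} → Joins x u v → Joins y u w → v ≢ w → x ≢ y
  edges-differ xuv yuw v≢w refl = v≢w (joins-other xuv yuw)

  joins-unique : ∀ {x y u v} → Joins x u v → Joins y u v → x ≡ y
  joins-unique {(_ , p)} {(_ , q)} (forward refl refl)  (forward refl refl)  = cong (_ ,_) (<-irrelevant p q)
  joins-unique {(_ , p)} {(_ , q)} (backward refl refl) (backward refl refl) = cong (_ ,_) (<-irrelevant p q)
  joins-unique {(_ , p)} {(_ , q)} (forward refl refl)  (backward refl refl) = ⊥-elim (<-asym p q)
  joins-unique {(_ , p)} {(_ , q)} (backward refl refl) (forward refl refl)  = ⊥-elim (<-asym p q)

  joins-between : ∀ {u v} → u ≢ v → ∃ λ x → Joins x u v
  joins-between {u} {v} u≢v with <-cmp u v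
  ... | tri< u<v _ _ = ((u , v) , u<v) , forward refl refl
  ... | tri≈ _ u≡v _ = contradiction u≡v u≢v
  ... | tri> _ _ v<u = ((v , u) , v<u) , backward refl refl

  _≟ₑ_ : DecidableEquality (Edge n)
  _≟ₑ_ = ≡-dec (≡-dec _≟_ _≟_) (λ p q → yes (<-irrelevant p q))

  anyEdge? : {P : Edge n → Set} → Decidable P → Dec (∃ P)
  anyEdge? {P} P? = map′ (λ (i , j , p , Px) → ((i , j) , p) , Px)
                         (λ (((i , j) , p) , Px) → i , j , p , Px)
                         (any? λ i → any? λ j → between? i j)
    where
    between? : ∀ i j → Dec (Σ (i F.< j) λ p → P ((i , j) , p))
    between? i j with i <? j
    ... | yes i<j = map′ (i<j ,_) (λ (p , Px) → subst (λ q → P ((i , j) , q)) (<-irrelevant p i<j) Px) (P? _)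
    ... | no  i≮j = no (i≮j ∘ proj₁)

  Linked : List (Edge n) → Fin n → Fin n → Set
  Linked E u v = Any (λ x → Joins x u v) E

  linked? : ∀ E u v → Dec (Linked E u v)
  linked? E u v = Any.any? (λ x → joins? x u v) E

  linked-sym : ∀ {E u v} → Linked E u v → Linked E v u
  linked-sym = Any.map joins-sym

  linked-≢ : ∀ {E u v} → Linked E u v → u ≢ v
  linked-≢ uv = joins-≢ (proj₂ (Any.satisfied uv))

  adj⇒linked : ∀ {E u v} → Adj E u v → Linked E u v
  adj⇒linked (inj₁ (_ , m)) = lose m (forward refl refl)
  adj⇒linked (inj₂ (_ , m)) = lose m (backward refl refl)

  linked-snoc : ∀ {E e u v} → Linked (E ++ [ e ]) u v → Linked E u v ⊎ Joins e u v
  linked-snoc {E} l with ++⁻ E l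
  ... | inj₁ old        = inj₁ old
  ... | inj₂ (here eJ)  = inj₂ eJ

  Exits : List (Fin n) → Edge n → Set
  Exits S x = ∃₂ λ u w → Joins x u w × u ∈ S × w ∉ S

  Leaks : List (Edge n) → List (Fin n) → Set
  Leaks M S = Any (Exits S) M

  outside : ∀ {w a b c : Fin n} → w ≢ a → w ≢ b → w ≢ c → w ∉ a ∷ b ∷ c ∷ []
  outside w≢a _   _   (here w≡a)                 = w≢a w≡a
  outside _   w≢b _   (there (here w≡b))         = w≢b w≡b
  outside _   _   w≢c (there (there (here w≡c))) = w≢c w≡c

  leaks-resp : ∀ {M M' S S'} → M ⊆ M' → S ↭ S' → Leaks M S → Leaks M' S'
  leaks-resp M⊆M' S↭S' = Any-resp-⊆ M⊆M' ∘ Any.map λ (u , w , xuw , u∈S , w∉S) →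
    u , w , xuw , ∈-resp-↭ S↭S' u∈S , w∉S ∘ ∈-resp-↭ (↭-sym S↭S')

  occ : Fin n → List (Fin n) → ℕ
  occ v S = sum (map (δ v) S)

  occ-allFin : ∀ v → occ v (allFin n) ≡ 1
  occ-allFin v = trans (cong sum (map-tabulate id (δ v))) (δ-total v)

  occ-∈ : ∀ {v S} → v ∈ S → 1 ≤ occ v S
  occ-∈ {v} (here refl) = ≤-trans (≤-reflexive (sym (δ-refl v))) (m≤m+n _ _)
  occ-∈     (there v∈S) = ≤-trans (occ-∈ v∈S) (m≤n+m _ _)

  occ-++ : ∀ v S₁ S₂ → occ v (S₁ ++ S₂) ≡ occ v S₁ + occ v S₂
  occ-++ v S₁ S₂ = trans (cong sum (map-++ (δ v) S₁ S₂)) (sum-++ (map (δ v) S₁) _)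

  load : List (Fin n) → Edge n → ℕ
  load S x = occ (lo x) S + occ (hi x) S

  load-↭ : ∀ {S S'} → S ↭ S' → ∀ x → load S x ≡ load S' x
  load-↭ S↭S' x = cong₂ _+_ (sum-↭ (map⁺ (δ (lo x)) S↭S')) (sum-↭ (map⁺ (δ (hi x)) S↭S'))

  load-++ : ∀ S₁ S₂ x → load (S₁ ++ S₂) x ≡ load S₁ x + load S₂ x
  load-++ S₁ S₂ x = trans (cong₂ _+_ (occ-++ (lo x) S₁ S₂) (occ-++ (hi x) S₁ S₂))
                          (interchange (occ (lo x) S₁) (occ (lo x) S₂) (occ (hi x) S₁) (occ (hi x) S₂))

  load-allFin : ∀ x → load (allFin n) x ≡ 2
  load-allFin x = cong₂ _+_ (occ-allFin (lo x)) (occ-allFin (hi x))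

  load-inner : ∀ {S x u v} → Joins x u v → u ∈ S → v ∈ S → 2 ≤ load S x
  load-inner (forward refl refl)  u∈S v∈S = +-mono-≤ (occ-∈ u∈S) (occ-∈ v∈S)
  load-inner (backward refl refl) u∈S v∈S = +-mono-≤ (occ-∈ v∈S) (occ-∈ u∈S)

  load-touch : ∀ {S x u w} → Joins x u w → u ∈ S → 1 ≤ load S x
  load-touch (forward refl refl)  u∈S = ≤-trans (occ-∈ u∈S) (m≤m+n _ _)
  load-touch (backward refl refl) u∈S = ≤-trans (occ-∈ u∈S) (m≤n+m _ _)

  weight : List (Fin n) → List (Edge n) → ℕ
  weight S M = sum (map (load S) M)

  weight-++ : ∀ S₁ S₂ M → weight (S₁ ++ S₂) M ≡ weight S₁ M + weight S₂ M
  weight-++ S₁ S₂ []      = refl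
  weight-++ S₁ S₂ (x ∷ M) =
    trans (cong₂ _+_ (load-++ S₁ S₂ x) (weight-++ S₁ S₂ M))
          (interchange (load S₁ x) (load S₂ x) (weight S₁ M) (weight S₂ M))

  weight-spanning : ∀ {S} → S ↭ allFin n → ∀ M → weight S M ≡ 2 * length M
  weight-spanning S↭V []      = refl
  weight-spanning S↭V (x ∷ M) =
    trans (cong₂ _+_ (trans (load-↭ S↭V x) (load-allFin x)) (weight-spanning S↭V M))
          (sym (*-suc 2 (length M)))

  inner-≢-exits : ∀ {S x y p q} → Joins y p q → p ∈ S → q ∈ S → Exits S x → y ≢ x
  inner-≢-exits ypq p∈S q∈S (u , w , xuw , _ , w∉S) refl with joins-ends ypq xuw
  ... | inj₁ (_ , w≡q) = w∉S (subst (_∈ _) (sym w≡q) q∈S)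
  ... | inj₂ (_ , w≡p) = w∉S (subst (_∈ _) (sym w≡p) p∈S)

  -- The three edges of a triangle abc and an edge leaving {a, b, c} are four
  -- distinct edges with 2 + 2 + 2 + 1 ends in {a, b, c}.
  triangle-weight : ∀ {M a b c xab xbc xac l} →
    xab ∈ M → xbc ∈ M → xac ∈ M → l ∈ M →
    Joins xab a b → Joins xbc b c → Joins xac a c → Exits (a ∷ b ∷ c ∷ []) l →
    7 ≤ weight (a ∷ b ∷ c ∷ []) M
  triangle-weight {M} {a} {b} {c} {xab} {xbc} {xac} {l}
                  xab∈ xbc∈ xac∈ l∈ jab jbc jac exits@(_ , _ , jl , u∈S , _) =
    ≤-trans ends (sum-distinct-≤ (load S) distinct members)
    where
    S : List (Fin n)
    S = a ∷ b ∷ c ∷ []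
    a∈S : a ∈ S
    a∈S = here refl
    b∈S : b ∈ S
    b∈S = there (here refl)
    c∈S : c ∈ S
    c∈S = there (there (here refl))

    distinct : Unique (xab ∷ xbc ∷ xac ∷ l ∷ [])
    distinct = (edges-differ (joins-sym jab) jbc (joins-≢ jac)
                ∷ edges-differ jab jac (joins-≢ jbc)
                ∷ inner-≢-exits jab a∈S b∈S exits ∷ [])
             ∷ (edges-differ (joins-sym jbc) (joins-sym jac) (joins-≢ (joins-sym jab))
                ∷ inner-≢-exits jbc b∈S c∈S exits ∷ [])
             ∷ (inner-≢-exits jac a∈S c∈S exits ∷ [])
             ∷ [] ∷ []

    members : xab ∷ xbc ∷ xac ∷ l ∷ [] ⊆ M
    members (here refl)                         = xab∈
    members (there (here refl))                 = xbc∈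
    members (there (there (here refl)))         = xac∈
    members (there (there (there (here refl)))) = l∈

    ends : 7 ≤ sum (map (load S) (xab ∷ xbc ∷ xac ∷ l ∷ []))
    ends = +-mono-≤ (load-inner jab a∈S b∈S) (+-mono-≤ (load-inner jbc b∈S c∈S)
             (+-mono-≤ (load-inner jac a∈S c∈S) (+-mono-≤ (load-touch jl u∈S) z≤n)))

  corners : Triple n → List (Fin n)
  corners (a , b , c) = a ∷ b ∷ c ∷ []

  leaky-triangle-weight : ∀ {M t} → TriangleIn M t → Leaks M (corners t) → 7 ≤ weight (corners t) M
  leaky-triangle-weight (ab , bc , ac) leak
    with _ , xab∈ , jab ← find (adj⇒linked ab) | _ , xbc∈ , jbc ← find (adj⇒linked bc)
       | _ , xac∈ , jac ← find (adj⇒linked ac) | _ , l∈ , exits ← find leak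
    = triangle-weight xab∈ xbc∈ xac∈ l∈ jab jbc jac exits

  factor-weight : ∀ {M T} → AllTri M T → (∀ {t} → TriangleIn M t → Leaks M (corners t)) →
                  7 * length T ≤ weight (verts T) M
  factor-weight                []           leaky = z≤n
  factor-weight {M} {t ∷ T} (tri ∷ tris) leaky = begin
    7 * suc (length T)                       ≡⟨ *-suc 7 (length T) ⟩
    7 + 7 * length T                         ≤⟨ +-mono-≤ (leaky-triangle-weight tri (leaky tri))
                                                          (factor-weight tris leaky) ⟩
    weight (corners t) M + weight (verts T) M ≡⟨ sym (weight-++ (corners t) (verts T) M) ⟩
    weight (verts (t ∷ T)) M                 ∎
    where open ≤-Reasoning

  length-verts : (T : List (Triple n)) → length (verts T) ≡ 3 * length T
  length-verts []      = refl
  length-verts (_ ∷ T) = trans (cong (3 +_) (length-verts T)) (sym (*-suc 3 (length T)))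

  leaky-factor-bound : ∀ {M} → (∀ {t} → TriangleIn M t → Leaks M (corners t)) →
                       ContainsTriangleFactor M → 7 * n ≤ 6 * length M
  leaky-factor-bound {M} leaky (T , tris , spanning) = begin
    7 * n                   ≡⟨ cong (7 *_) size ⟩
    7 * (3 * length T)      ≡⟨ sym (*-assoc 7 3 (length T)) ⟩
    21 * length T           ≡⟨ *-assoc 3 7 (length T) ⟩
    3 * (7 * length T)      ≤⟨ *-monoʳ-≤ 3 (factor-weight tris leaky) ⟩
    3 * weight (verts T) M  ≡⟨ cong (3 *_) (weight-spanning spanning M) ⟩
    3 * (2 * length M)      ≡⟨ sym (*-assoc 3 2 (length M)) ⟩
    6 * length M            ∎
    where
    open ≤-Reasoning
    size : n ≡ 3 * length T
    size = trans (sym (length-tabulate id)) (trans (sym (↭-length spanning)) (length-verts T))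

  Guarded : List (Edge n) → List (Edge n) → Set
  Guarded M B = ∀ {a b c} → Linked M a b → Linked M a c → b ≢ c →
                Leaks M (a ∷ b ∷ c ∷ []) ⊎ Linked B b c

  Closes : List (Edge n) → Edge n → Edge n → Set
  Closes M e y = ∃ λ u → ∃ λ v → ∃ λ w → Joins e u v × Linked M u w × Joins y v w

  closes? : ∀ M e y → Dec (Closes M e y)
  closes? M e y = any? λ u → any? λ v → any? λ w → joins? e u v ×-dec linked? M u w ×-dec joins? y v w

  Blocks : List (Edge n) → List (Edge n) → Edge n → Edge n → Set
  Blocks g M e y = y ∉ g × Closes M e y

  module Move {h : List (Edge n)} {e : Edge n} (e∉h : e ∉ h) where

    M B M' : List (Edge n)
    M  = makerEdges h
    B  = breakerEdges h
    M' = M ++ [ e ]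

    still-free : ∀ {a b c} → Joins e a b → a ≢ c → ¬ Linked h b c → ¬ Linked (h ++ [ e ]) b c
    still-free eab a≢c bc-free bc with linked-snoc bc
    ... | inj₁ old = bc-free old
    ... | inj₂ ebc = a≢c (joins-other (joins-sym eab) ebc)

    -- A Maker triangle with two old edges at a is leaky, by the guarantee at a:
    -- Breaker cannot own bc, since bc is Maker's (old, or the fresh edge e).
    corner-leaks : ∀ {a b c} → Guarded M B → Disjoint M B →
                   Linked M a b → Linked M a c → Linked M' b c → Leaks M' (a ∷ b ∷ c ∷ [])
    corner-leaks guarded disjoint ab ac bc with guarded ab ac (linked-≢ bc)
    ... | inj₁ leaks = leaks-resp ∈-++⁺ˡ ↭-refl leaks
    ... | inj₂ bcB with find bcB | find bc
    ... | q , q∈B , qbc | r , r∈M' , rbc with ∈-++⁻ M (subst (_∈ M') (joins-unique rbc qbc) r∈M')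
    ...   | inj₁ q∈M         = ⊥-elim (disjoint (q∈M , q∈B))
    ...   | inj₂ (here refl) = ⊥-elim (e∉h (breakerEdges-⊆ h q∈B))

    -- After the move every Maker triangle is leaky: at most one of its edges is e,
    -- so some corner has two old edges.
    triangles-leak : Guarded M B → Disjoint M B → ∀ {t} → TriangleIn M' t → Leaks M' (corners t)
    triangles-leak guarded disjoint {a , b , c} (ab , bc , ac)
      with linked-snoc (adj⇒linked ab) | linked-snoc (adj⇒linked bc) | linked-snoc (adj⇒linked ac)
    ... | inj₁ ab' | _        | inj₁ ac' = corner-leaks guarded disjoint ab' ac' (adj⇒linked bc)
    ... | inj₂ _   | inj₁ bc' | inj₁ ac' =
      leaks-resp id (rotate a b c)
        (corner-leaks guarded disjoint (linked-sym ac') (linked-sym bc') (adj⇒linked ab))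
    ... | inj₁ ab' | inj₁ bc' | inj₂ _   =
      leaks-resp id (swap b a ↭-refl) (corner-leaks guarded disjoint (linked-sym ab') bc' (adj⇒linked ac))
    ... | inj₂ eab | inj₂ ebc | _        =
      contradiction (joins-other (joins-sym eab) ebc) (linked-≢ (adj⇒linked ac))
    ... | inj₂ eab | _        | inj₂ eac =
      contradiction (joins-other eab eac) (linked-≢ (adj⇒linked bc))
    ... | _        | inj₂ ebc | inj₂ eac =
      contradiction (joins-other (joins-sym ebc) (joins-sym eac)) (≢-sym (linked-≢ (adj⇒linked ab)))

    module Reply {y : Edge n} (y∉ : y ∉ h ++ [ e ])
                 (blocks : ∃ (Blocks (h ++ [ e ]) M' e) → Blocks (h ++ [ e ]) M' e y) where

      B' : List (Edge n)
      B' = B ++ [ y ]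

      -- The reply y = vw closes a cherry e = uv, f = uw with {u, v} = {a, b}:
      -- either w = c and y is bc, or w ∉ {a, b, c} and f leaves {a, b, c}.
      reply-guards : ∀ {a b c} → Joins e a b → ¬ Linked h b c → Closes M' e y →
                     Leaks M' (a ∷ b ∷ c ∷ []) ⊎ Linked B' b c
      reply-guards {c = c} eab bc-free (u , v , w , euv , uw , yvw) with find uw | joins-ends eab euv | w ≟ c
      ... | f , f∈ , fuw | inj₁ (refl , refl) | no w≢c =
        inj₁ (lose f∈ (u , w , fuw , here refl , outside (≢-sym (joins-≢ fuw)) (≢-sym (joins-≢ yvw)) w≢c))
      ... | f , f∈ , fuw | inj₂ (refl , refl) | no w≢c =
        inj₁ (lose f∈ (u , w , fuw , there (here refl) , outside (≢-sym (joins-≢ yvw)) (≢-sym (joins-≢ fuw)) w≢c))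
      ... | _ | inj₁ (refl , refl) | yes refl = inj₂ (lose (∈-++⁺ʳ B (here refl)) yvw)
      ... | f , f∈ , fuw | inj₂ (refl , refl) | yes refl =
        ⊥-elim (still-free eab (joins-≢ yvw) bc-free (lose (++⁺ˡ [ e ] (makerEdges-⊆ h) f∈) fuw))

      fresh-cherry : ∀ {a b c} → Guarded M B → Joins e a b → Linked M a c → b ≢ c →
                     Leaks M' (a ∷ b ∷ c ∷ []) ⊎ Linked B' b c
      fresh-cherry {a} {b} {c} guarded eab ac b≢c with linked? h b c
      ... | no bc-free with z , zbc ← joins-between b≢c =
        reply-guards eab bc-free (proj₂ (blocks (z , z-free , a , b , c , eab , Any-resp-⊆ ∈-++⁺ˡ ac , zbc)))
        where
        z-free : z ∉ h ++ [ e ]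
        z-free z∈ = still-free eab (linked-≢ ac) bc-free (lose z∈ zbc)
      ... | yes bc with find bc
      ... | x , x∈h , xbc with claimed-by h x∈h
      ...   | inj₂ x∈B = inj₂ (lose (∈-++⁺ˡ x∈B) xbc)
      ...   | inj₁ x∈M with guarded (linked-sym ac) (linked-sym (lose x∈M xbc)) (joins-≢ eab)
      ...     | inj₁ leaks = inj₁ (leaks-resp ∈-++⁺ˡ (rotate a b c) leaks)
      ...     | inj₂ abB with find abB
      ...       | q , q∈B , qab = ⊥-elim (e∉h (subst (_∈ h) (joins-unique qab eab) (breakerEdges-⊆ h q∈B)))

      guarded-step : Guarded M B → Guarded M' B'
      guarded-step guarded ab ac b≢c with linked-snoc ab | linked-snoc ac
      ... | inj₁ ab' | inj₁ ac' =
        Sum.map (leaks-resp ∈-++⁺ˡ ↭-refl) (Any-resp-⊆ ∈-++⁺ˡ) (guarded ab' ac' b≢c)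
      ... | inj₂ eab | inj₁ ac' = fresh-cherry guarded eab ac' b≢c
      ... | inj₁ ab' | inj₂ eac =
        Sum.map (leaks-resp id (prep _ (swap _ _ ↭-refl))) linked-sym (fresh-cherry guarded eac ab' (≢-sym b≢c))
      ... | inj₂ eab | inj₂ eac = contradiction (joins-other eab eac) b≢c

      -- Both moves of the round were free, so the players' edges stay disjoint.
      disjoint-step : Disjoint M B → Disjoint M' B'
      disjoint-step disjoint (x∈M' , x∈B') with ∈-++⁻ M x∈M' | ∈-++⁻ B x∈B'
      ... | inj₁ x∈M         | inj₁ x∈B         = disjoint (x∈M , x∈B)
      ... | inj₁ x∈M         | inj₂ (here refl) = y∉ (∈-++⁺ˡ (makerEdges-⊆ h x∈M))
      ... | inj₂ (here refl) | inj₁ x∈B         = e∉h (breakerEdges-⊆ h x∈B)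
      ... | inj₂ (here refl) | inj₂ (here refl) = y∉ (∈-++⁺ʳ h (here refl))

  -- Breaker's strategy; d is an arbitrary edge, used only when no choice exists.
  module Strategy (d : Edge n) where

    pick : {P : Edge n → Set} → Decidable P → Edge n → Edge n
    pick P? z with anyEdge? P?
    ... | yes (x , _) = x
    ... | no  _       = z

    pick-found : ∀ {P : Edge n → Set} (P? : Decidable P) z → ∃ P → P (pick P? z)
    pick-found P? z p with anyEdge? P?
    ... | yes (_ , Px) = Px
    ... | no  ¬p       = contradiction p ¬p

    pick-or-default : ∀ {P : Edge n → Set} (P? : Decidable P) z → P (pick P? z) ⊎ pick P? z ≡ z
    pick-or-default P? z with anyEdge? P?
    ... | yes (_ , Px) = inj₁ Px
    ... | no  _        = inj₂ refl

    -- Maker's most recent edge in a history.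
    latest : List (Edge n) → Edge n
    latest = foldl (λ _ x → x) d

    latest-snoc : ∀ h e → latest (h ++ [ e ]) ≡ e
    latest-snoc h e = foldl-++ (λ _ x → x) d h [ e ]

    free? : ∀ g y → Dec (y ∉ g)
    free? g y = ¬? (member? _≟ₑ_ y g)

    blocks? : ∀ g M e y → Dec (Blocks g M e y)
    blocks? g M e y = free? g y ×-dec closes? M e y

    reply : BreakerStrategy n
    reply g = pick (blocks? g (makerEdges g) (latest g)) (pick (free? g) d)

    reply-legal : LegalBreaker reply
    reply-legal g free with pick-or-default (blocks? g (makerEdges g) (latest g)) (pick (free? g) d)
    ... | inj₁ (y∉g , _) = y∉g
    ... | inj₂ fallback  = subst (_∉ g) (sym fallback) (pick-found (free? g) d free)

    reply-blocks : ∀ g → ∃ (Blocks g (makerEdges g) (latest g)) → Blocks g (makerEdges g) (latest g) (reply g)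
    reply-blocks g = pick-found (blocks? g (makerEdges g) (latest g)) _

    record Invariant (h : List (Edge n)) (k : ℕ) : Set where
      field
        paired : Paired h
        rounds : length (makerEdges h) ≡ k
        -- while the board is not full, Breaker's guarantee holds and no edge was claimed twice
        safe   : ∀ {e} → e ∉ h →
                 Guarded (makerEdges h) (breakerEdges h) × Disjoint (makerEdges h) (breakerEdges h)

    invariant : ∀ {h k} → Reachable reply h k → Invariant h k
    invariant start = record { paired = [] ; rounds = refl ; safe = λ _ → (λ {_} {_} {_} ()) , λ { (() , _) } }
    invariant (step {h} r e e∉h) = record
      { paired = paired-snoc e y paired
      ; rounds = trans (cong length (makerEdges-++ paired (e ∷ y ∷ [])))
                       (trans (length-snoc (makerEdges h) e) (cong suc rounds))
      ; safe   = safe′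
      }
      where
      open Invariant (invariant r)
      open Move e∉h
      g : List (Edge n)
      g = h ++ [ e ]
      y : Edge n
      y = reply g

      blocks : ∃ (Blocks g M' e) → Blocks g M' e y
      blocks = subst₂ (λ M x → ∃ (Blocks g M x) → Blocks g M x y)
                      (makerEdges-++ paired [ e ]) (latest-snoc h e) (reply-blocks g)

      safe′ : ∀ {e'} → e' ∉ h ++ e ∷ y ∷ [] →
              Guarded (makerEdges (h ++ e ∷ y ∷ [])) (breakerEdges (h ++ e ∷ y ∷ [])) ×
              Disjoint (makerEdges (h ++ e ∷ y ∷ [])) (breakerEdges (h ++ e ∷ y ∷ []))
      safe′ {e'} e'∉ =
        subst₂ (λ M B → Guarded M B × Disjoint M B)
               (sym (makerEdges-++ paired (e ∷ y ∷ []))) (sym (breakerEdges-++ paired (e ∷ y ∷ [])))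
               (guarded-step (proj₁ (safe e∉h)) , disjoint-step (proj₂ (safe e∉h)))
        where
        y∉ : y ∉ g
        y∉ = reply-legal g (e' , e'∉ ∘ ++⁺ʳ h (xs⊆xs++ys [ e ] [ y ]))
        open Reply y∉ blocks

    reply-delays : ∀ (h : List (Edge n)) (k : ℕ) → Reachable reply h k →
                   ∀ (e : Edge n) → e ∉ h → 6 * suc k < 7 * n →
                   ¬ ContainsTriangleFactor (makerEdges (h ++ [ e ]))
    reply-delays h k r e e∉h early factor = <⇒≱ early (begin
      7 * n          ≤⟨ leaky-factor-bound (triangles-leak guarded disjoint) factor′ ⟩
      6 * length M'  ≡⟨ cong (6 *_) (trans (length-snoc M e) (cong suc rounds)) ⟩
      6 * suc k      ∎)
      where
      open ≤-Reasoning
      open Invariant (invariant r)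
      open Move e∉h
      guarded : Guarded M B
      guarded = proj₁ (safe e∉h)
      disjoint : Disjoint M B
      disjoint = proj₂ (safe e∉h)
      factor′ : ContainsTriangleFactor M'
      factor′ = subst ContainsTriangleFactor (makerEdges-++ paired [ e ]) factor

some-edge : ∀ {n} → 2 ≤ n → Edge n
some-edge (s≤s (s≤s _)) = (F.zero , F.suc F.zero) , s≤s z≤n

-- Divisibility by 3 only serves to guarantee n ≥ 3; the bound itself comes
-- from counting (a triangle factor forces n = 3|T| anyway).
theorem4p3 : (n : ℕ) → .{{NonZero n}} → 3 ∣ n →
    Σ (BreakerStrategy n) λ sB → LegalBreaker sB ×
      (∀ (h : List (Edge n)) (k : ℕ) → Reachable sB h k →
        ∀ (e : Edge n) → e ∉ h → 6 * suc k < 7 * n →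
        ¬ ContainsTriangleFactor (makerEdges (h ++ [ e ])))
theorem4p3 n 3∣n = reply , reply-legal , reply-delays
  where open Strategy (some-edge (<⇒≤ (∣⇒≤ 3∣n)))
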